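{- For every program $P\in\mathcal{C}$, every set of states $W\subseteq\mathcal{U}$ and every formula $\alpha\in\mathcal{L}^m_K$ with free variables in $\mathbf{p}$, $F(P,W)\models\alpha$ if and only if $W\models wp(P,\alpha)$.
   Context: Agents and variables: $Ag=\{a_1,\dots,a_m\}$ is a finite set of agents. $\mathcal{V}$ is a set of variables, each typed with the group of agents that can observe it, written $x_G$ with $G \subseteq Ag$. A nonempty subset $\mathbf{p}\subseteq \mathcal{V}$ consists of program variables. $\mathsf{D}$ is a domain; $\mathcal{L}_{QF}$ is a quantifier-free first-order language over $\mathcal{V}$ with a fixed interpretation over $\mathsf{D}$. States: a state is a function $s$ from $\mathsf{dom}(s)\subseteq\mathcal{V}$ to $\mathsf{D}$; $\mathcal{U}$ is the set of all states. $s[x\mapsto c]$ is $s$ updated at $x$ to $c$; $s(e)$ is the value of a term $e$ at $s$; $W[x\mapsto c]=\{s[x\mapsto c]\mid s\in W\}$. $\mathrm{obs}_a=\{x_G\in\mathcal{V}\mid a\in G\}$; $s\approx_a s'$ iff $s(x)=s'(x)$ for all $x\in(\mathsf{dom}(s)\cup\mathsf{dom}(s'))\cap\mathrm{obs}_a$. A set $W\subseteq\mathcal{U}$ is an epistemic model with the relations $\approx_a$ restricted to $W$. Logic $\mathcal{L}^m_K$: $\alpha ::= \pi \mid \alpha\wedge\alpha \mid \neg\alpha \mid K_{a}\alpha \mid [\alpha']\alpha \mid \forall x_G\cdot\alpha$, $\pi\in\mathcal{L}_{QF}$. Semantics at $(W,s)$, $s\in W$: $(W,s)\models\pi$ iff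 $\pi$ is true at $s$; connectives as usual; $(W,s)\models K_a\alpha$ iff $(W,s')\models\alpha$ for all $s'\in W$ with $s'\approx_a s$; $(W,s)\models[\beta]\alpha$ iff $(W,s)\models\beta$ implies $(W_{|\beta},s)\models\alpha$, $W_{|\beta}=\{s'\in W\mid (W,s')\models\beta\}$; for $x_G\notin\mathsf{dom}(W)$, $(W,s)\models\forall x_G\cdot\alpha$ iff for all $c\in\mathsf{D}$, $(\bigcup_{d\in\mathsf{D}}W[x_G\mapsto d],s[x_G\mapsto c])\models\alpha$. $W\models\alpha$ means $(W,s)\models\alpha$ for all $s\in W$. Programs $\mathcal{C}$: $P ::= \varphi? \mid x_G:=e \mid \mathbf{new}\ k_G\cdot P \mid P;Q \mid P\sqcup Q$, with $\varphi\in\mathcal{L}^m_K$, $e$ a term of $\mathcal{L}_{QF}$, and all variables of $P$ not bound by $\mathbf{new}$ in $\mathbf{p}$. Relational semantics on models: $F(x_G:=e,W)=\{s[k_G\mapsto s(x_G),x_G\mapsto s(e)]\mid s\in W\}$; $F(P;Q,W)=F(Q,F(P,W))$; $F(\mathbf{new}\ k_G\cdot P,W)=F(P,\bigcup_{d\in\mathsf{D}}W[k_G\mapsto d])$; $F(P\sqcup Q,W)=\{s[c_{Ag}\mapsto l]\mid s\in F(P,W)\}\cup\{s[c_{Ag}\mapsto r]\mid s\in F(Q,W)\}$; $F(\beta?,W)=\{s\in W\mid (W,s)\models\beta\}$; here $k_G$, $c_{Ag}$ are fresh variables not in the domain of the states, $c_{Ag}$ is observable by all agents, and $l\neq r$ are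 fixed values. Weakest precondition (for $\alpha$ with free variables in $\mathbf{p}$): $wp(P;Q,\alpha)=wp(P,wp(Q,\alpha))$; $wp(P\sqcup Q,\alpha)=wp(P,\alpha)\wedge wp(Q,\alpha)$; $wp(\mathbf{new}\ k_G\cdot P,\alpha)=\forall k_G\cdot wp(P,\alpha)$; $wp(\beta?,\alpha)=[\beta]\alpha$; $wp(x_G:=e,\alpha)=\forall k_G\cdot[k_G=e](\alpha[x_G\backslash k_G])$ with $k_G$ fresh, where $\alpha[x\backslash t]$ denotes substitution of $t$ for $x$. -}

module Defs where

open import Data.Nat using (ℕ)
import Data.Nat.Properties as ℕP
open import Data.Bool using (Bool; true; false)
import Data.Bool.Properties as BP
open import Data.Maybe using (Maybe; just; nothing)
open import Data.Vec using (Vec; []; _∷_)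
import Data.Vec.Properties as VP
open import Data.List using (List; []; _∷_; _++_; filter)
open import Data.List.Relation.Unary.All using (All)
open import Data.List.Membership.Propositional using (_∈_; _∉_)
open import Data.Fin using (Fin)
open import Data.Fin.Subset using (Subset) renaming (_∈_ to _∈ˢ_; ⊤ to Ag)
open import Data.Product using (Σ; _×_; _,_)
open import Data.Sum using (_⊎_)
open import Relation.Nullary using (¬_; Dec; yes; no; ¬?)
open import Relation.Binary.Definitions using (DecidableEquality)
open import Relation.Binary.PropositionalEquality using (_≡_; refl; cong₂)

-- First-order signature with a fixed interpretation over the domain D.
-- (Constants are 0-ary function symbols; equality is built in.)

record Signature : Set₁ where
  field
    D       : Set
    Fun     : Set
    fArity  : Fun → ℕ
    fInterp : (f : Fun) → Vec D (fArity f) → D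
    Rel     : Set
    rArity  : Rel → ℕ
    rInterp : (R : Rel) → Vec D (rArity R) → Set

-- Variables x_G : a name together with the group G ⊆ Ag = Fin m of
-- agents that can observe it.  Every group has infinitely many names.

record Var (m : ℕ) : Set where
  constructor var
  field
    name : ℕ
    grp  : Subset m

_≟V_ : ∀ {m} → DecidableEquality (Var m)
var n G ≟V var n′ G′ with n ℕP.≟ n′ | VP.≡-dec BP._≟_ G G′
... | yes refl | yes refl = yes refl
... | no n≢    | _        = no λ { refl → n≢ refl }
... | yes _    | no G≢    = no λ { refl → G≢ refl }

-- The theory, for m agents, a signature S and the two fixed distinct
-- values l, r ∈ D used to mark the branches of a choice.

module Theory (m : ℕ) (S : Signature) (l r : Signature.D S) where
  open Signature S

  data Term : Set where
    v   : Var m → Term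
    app : (f : Fun) → Vec Term (fArity f) → Term

  data QF : Set where
    _≐_  : Term → Term → QF
    rel  : (R : Rel) → Vec Term (rArity R) → QF
    _∧q_ : QF → QF → QF
    ¬q_  : QF → QF

  data Form : Set where
    qf   : QF → Form
    fand : Form → Form → Form
    fneg : Form → Form
    fK   : Fin m → Form → Form
    fann : Form → Form → Form
    fall : Var m → Form → Form

  State : Set
  State = Var m → Maybe D

  Model : Set₁
  Model = State → Set

  _[_↦_] : State → Var m → Maybe D → State
  (s [ x ↦ c ]) y with y ≟V x
  ... | yes _ = c
  ... | no _  = s y

  mutual
    eval : State → Term → Maybe D
    eval s (v x)      = s x
    eval s (app f ts) with evalV s ts
    ... | just as = just (fInterp f as)
    ... | nothing = nothing

    evalV : ∀ {n} → State → Vec Term n → Maybe (Vec D n)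
    evalV s []       = just []
    evalV s (t ∷ ts) with eval s t | evalV s ts
    ... | just a  | just as = just (a ∷ as)
    ... | just _  | nothing = nothing
    ... | nothing | _       = nothing

  _⊨q_ : State → QF → Set
  s ⊨q (t ≐ u)    = Σ D λ a → eval s t ≡ just a × eval s u ≡ just a
  s ⊨q rel R ts   = Σ (Vec D (rArity R)) λ as → evalV s ts ≡ just as × rInterp R as
  s ⊨q (π ∧q ρ)   = s ⊨q π × s ⊨q ρ
  s ⊨q (¬q π)     = ¬ (s ⊨q π)

  _≈⟨_⟩_ : State → Fin m → State → Set
  s ≈⟨ a ⟩ s′ = ∀ (x : Var m) → a ∈ˢ Var.grp x → s x ≡ s′ x

  -- ⋃_{d ∈ D} W[x ↦ d]   (as a set of functions: membership up to pointwise equality)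
  Cyl : Var m → Model → Model
  Cyl x W s′ = Σ State λ s → W s × Σ D λ d → (∀ y → s′ y ≡ (s [ x ↦ just d ]) y)

  Img : (State → State) → Model → Model
  Img f W s′ = Σ State λ s → W s × (∀ y → s′ y ≡ f s y)

  _,_⊨_ : Model → State → Form → Set
  W , s ⊨ qf π      = s ⊨q π
  W , s ⊨ fand α β  = (W , s ⊨ α) × (W , s ⊨ β)
  W , s ⊨ fneg α    = ¬ (W , s ⊨ α)
  W , s ⊨ fK a α    = ∀ s′ → W s′ → s′ ≈⟨ a ⟩ s → W , s′ ⊨ α
  W , s ⊨ fann β α  = W , s ⊨ β → (λ s′ → W s′ × (W , s′ ⊨ β)) , s ⊨ α
  W , s ⊨ fall x α  = ∀ (c : D) → Cyl x W , (s [ x ↦ just c ]) ⊨ α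

  _⊨M_ : Model → Form → Set
  W ⊨M α = ∀ s → W s → W , s ⊨ α

  mutual
    termVars : Term → List (Var m)
    termVars (v x)      = x ∷ []
    termVars (app f ts) = termVarsV ts

    termVarsV : ∀ {n} → Vec Term n → List (Var m)
    termVarsV []       = []
    termVarsV (t ∷ ts) = termVars t ++ termVarsV ts

  qfVars : QF → List (Var m)
  qfVars (t ≐ u)   = termVars t ++ termVars u
  qfVars (rel R ts) = termVarsV ts
  qfVars (π ∧q ρ)  = qfVars π ++ qfVars ρ
  qfVars (¬q π)    = qfVars π

  formVars : Form → List (Var m)
  formVars (qf π)     = qfVars π
  formVars (fand α β) = formVars α ++ formVars β
  formVars (fneg α)   = formVars α
  formVars (fK a α)   = formVars α
  formVars (fann β α) = formVars β ++ formVars α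
  formVars (fall x α) = x ∷ formVars α

  freeVars : Form → List (Var m)
  freeVars (qf π)     = qfVars π
  freeVars (fand α β) = freeVars α ++ freeVars β
  freeVars (fneg α)   = freeVars α
  freeVars (fK a α)   = freeVars α
  freeVars (fann β α) = freeVars β ++ freeVars α
  freeVars (fall x α) = filter (λ y → ¬? (y ≟V x)) (freeVars α)

  boundVars : Form → List (Var m)
  boundVars (qf π)     = []
  boundVars (fand α β) = boundVars α ++ boundVars β
  boundVars (fneg α)   = boundVars α
  boundVars (fK a α)   = boundVars α
  boundVars (fann β α) = boundVars β ++ boundVars α
  boundVars (fall x α) = x ∷ boundVars α

  mutual
    substT : Var m → Var m → Term → Term
    substT x k (v y) with y ≟V x
    ... | yes _ = v k
    ... | no _  = v y
    substT x k (app f ts) = app f (substTV x k ts)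

    substTV : ∀ {n} → Var m → Var m → Vec Term n → Vec Term n
    substTV x k []       = []
    substTV x k (t ∷ ts) = substT x k t ∷ substTV x k ts

  substQ : Var m → Var m → QF → QF
  substQ x k (t ≐ u)    = substT x k t ≐ substT x k u
  substQ x k (rel R ts) = rel R (substTV x k ts)
  substQ x k (π ∧q ρ)   = substQ x k π ∧q substQ x k ρ
  substQ x k (¬q π)     = ¬q substQ x k π

  substF : Var m → Var m → Form → Form
  substF x k (qf π)     = qf (substQ x k π)
  substF x k (fand α β) = fand (substF x k α) (substF x k β)
  substF x k (fneg α)   = fneg (substF x k α)
  substF x k (fK a α)   = fK a (substF x k α)
  substF x k (fann β α) = fann (substF x k β) (substF x k α)
  substF x k (fall y α) with y ≟V x
  ... | yes _ = fall y α
  ... | no _  = fall y (substF x k α)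

  -- The fresh variables used by the semantics are recorded
  -- explicitly in the syntax: 'assign x e k' is x_G := e whose fresh
  -- variable k_G stores the old value of x_G, and 'choice c P Q' is
  -- P ⊔ Q whose fresh variable c_Ag records the branch taken.

  data Prog : Set where
    test   : Form → Prog
    assign : Var m → Term → Var m → Prog
    new    : Var m → Prog → Prog
    seq    : Prog → Prog → Prog
    choice : Var m → Prog → Prog → Prog

  F : Prog → Model → Model
  F (test β)       W = λ s → W s × (W , s ⊨ β)
  F (assign x e k) W = Img (λ s → (s [ k ↦ s x ]) [ x ↦ eval s e ]) W
  F (new k P)      W = F P (Cyl k W)
  F (seq P Q)      W = F Q (F P W)
  F (choice c P Q) W = λ s′ → Img (λ s → s [ c ↦ just l ]) (F P W) s′
                            ⊎ Img (λ s → s [ c ↦ just r ]) (F Q W) s′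

  wp : Prog → Form → Form
  wp (test β)       α = fann β α
  wp (assign x e k) α = fall k (fann (qf (v k ≐ e)) (substF x k α))
  wp (new k P)      α = fall k (wp P α)
  wp (seq P Q)      α = wp P (wp Q α)
  wp (choice c P Q) α = fand (wp P α) (wp Q α)

  intro : Prog → List (Var m)
  intro (test φ)       = []
  intro (assign x e k) = k ∷ []
  intro (new k P)      = k ∷ intro P
  intro (seq P Q)      = intro P ++ intro Q
  intro (choice c P Q) = c ∷ intro P ++ intro Q

  auxVars : Prog → List (Var m)
  auxVars (test φ)       = []
  auxVars (assign x e k) = k ∷ []
  auxVars (new k P)      = auxVars P
  auxVars (seq P Q)      = auxVars P ++ auxVars Q
  auxVars (choice c P Q) = c ∷ auxVars P ++ auxVars Q

  usedVars : Prog → List (Var m)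
  usedVars (test φ)       = formVars φ
  usedVars (assign x e k) = x ∷ termVars e
  usedVars (new k P)      = usedVars P
  usedVars (seq P Q)      = usedVars P ++ usedVars Q
  usedVars (choice c P Q) = usedVars P ++ usedVars Q

  -- WF sc df P :  sc = variables in scope (p plus enclosing 'new' binders),
  --               df = variables already in the domain of the states.
  -- Free variables of P lie in sc (P ∈ C); fresh variables are outside
  -- the current domain and carry the right group; quantified variables of
  -- tests are outside the current domain (as required by the ∀-clause).
  WF : (Var m → Set) → (Var m → Set) → Prog → Set
  WF sc df (test φ)       = All sc (freeVars φ) × All (λ y → ¬ df y) (boundVars φ)
  WF sc df (assign x e k) = sc x × All sc (termVars e) × ¬ df k × Var.grp k ≡ Var.grp x
  WF sc df (new k P)      = ¬ df k × WF (λ y → sc y ⊎ y ≡ k) (λ y → df y ⊎ y ≡ k) P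
  WF sc df (seq P Q)      = WF sc df P × WF sc (λ y → df y ⊎ y ∈ intro P) Q
  WF sc df (choice c P Q) = ¬ df c × c ∉ intro P × c ∉ intro Q × Var.grp c ≡ Ag
                            × WF sc df P × WF sc df Q

  InDom : Model → Var m → Set
  InDom W y = Σ State λ s → W s × Σ D λ d → s y ≡ just d

module Submission where

-- Induction on P, generalised over the model W: W must be closed under pointwise equality of
-- states, define every variable in scope, and have its domain inside a set df that all fresh
-- variables avoid.  Tests, sequencing and `new` then match their weakest preconditions directly.
-- For x := e, the image of W is, up to the transposition σ of x and k, the cylinder
-- ⋃_d W[k ↦ d] restricted to k = e; σ preserves every ≈_a because x and k belong to the same
-- group, so α holds on the image exactly when α[x\k] holds on that cylinder.  For P ⊔ Q, the
-- tag c is observed by every agent, so no ≈_a relates states of different branches and α is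
-- evaluated in each branch as in F(P, W), resp. F(Q, W).

open import Defs
open import Data.Nat using (ℕ)
open import Data.Maybe using (Maybe; just; nothing)
open import Data.Maybe.Properties using (just-injective)
open import Data.Vec using (Vec; []; _∷_)
open import Data.Fin.Subset using () renaming (_∈_ to _∈ˢ_; ⊤ to Ag)
open import Data.Fin.Subset.Properties using (∈⊤)
open import Data.List using ([]; _∷_; _++_; filter)
open import Data.List.Relation.Unary.All using (All; []; _∷_)
import Data.List.Relation.Unary.All as All
import Data.List.Relation.Unary.All.Properties as All
open import Data.List.Relation.Unary.Any using (here; there)
open import Data.List.Membership.Propositional using (_∈_; _∉_)
open import Data.List.Membership.Propositional.Properties using (∈-++⁺ˡ; ∈-++⁺ʳ; ∈-filter⁺; ∈-filter⁻)
open import Data.Product using (Σ; _×_; _,_; proj₁; proj₂)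
open import Data.Product.Function.NonDependent.Propositional using (_×-⇔_)
open import Data.Sum using (_⊎_; inj₁; inj₂)
import Data.Sum as Sum
open import Function using (_∘_)
open import Function.Bundles using (_⇔_; mk⇔; Equivalence)
import Function.Properties.Equivalence as ⇔
open import Function.Related.Propositional using (module EquationalReasoning)
open import Function.Related.TypeIsomorphisms using (→-cong-⇔; ¬-cong-⇔)
open import Relation.Nullary using (¬_; ¬?; Dec; yes; no; contradiction)
open import Relation.Unary using (_∪_)
import Relation.Unary as U
open import Relation.Binary.Bundles using (Setoid)
open import Relation.Binary.PropositionalEquality
  using (_≡_; _≢_; refl; sym; trans; cong; cong₂; subst; _≗_; _→-setoid_; module ≡-Reasoning)

open Equivalence using (to; from)

Π-⇔ : ∀ {A : Set} {B C : A → Set} → (∀ a → B a ⇔ C a) → (∀ a → B a) ⇔ (∀ a → C a)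
Π-⇔ B⇔C = mk⇔ (λ f a → to (B⇔C a) (f a)) (λ g a → from (B⇔C a) (g a))

All-filter⇔ : ∀ {A : Set} {P Q : A → Set} (P? : U.Decidable P) xs →
              All Q (filter P? xs) ⇔ All (λ y → P y → Q y) xs
All-filter⇔ P? xs = mk⇔
  (λ all → All.tabulate λ y∈ Py → All.lookup all (∈-filter⁺ P? y∈ Py))
  (λ all → All.tabulate λ y∈ → let y∈xs , Py = ∈-filter⁻ P? {xs = xs} y∈ in All.lookup all y∈xs Py)

module Semantics (m : ℕ) (S : Signature) (l r : Signature.D S) where
  open Signature S
  open Theory m S l r

  Extensional : Model → Set
  Extensional M = ∀ {s t} → s ≗ t → M s → M t

  infix 4 _≋_
  _≋_ : Model → Model → Set
  M ≋ N = ∀ s → M s ⇔ N s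

  _∣_ : Model → Form → Model
  (M ∣ β) s = M s × (M , s ⊨ β)

  module ≗ = Setoid (Var m →-setoid Maybe D)

  Defined : Maybe D → Set
  Defined mv = Σ D λ d → mv ≡ just d

  update-at : ∀ s x c → (s [ x ↦ c ]) x ≡ c
  update-at s x c with x ≟V x
  ... | yes _   = refl
  ... | no x≢x = contradiction refl x≢x

  update-elsewhere : ∀ s {x} c {y} → y ≢ x → (s [ x ↦ c ]) y ≡ s y
  update-elsewhere s {x} c {y} y≢x with y ≟V x
  ... | yes y≡x = contradiction y≡x y≢x
  ... | no _    = refl

  update-cong : ∀ {s t} x c → s ≗ t → s [ x ↦ c ] ≗ t [ x ↦ c ]
  update-cong x c s≗t y with y ≟V x
  ... | yes _ = refl
  ... | no _  = s≗t y

  update-comm : ∀ s {x y} c d → x ≢ y → (s [ x ↦ c ]) [ y ↦ d ] ≗ (s [ y ↦ d ]) [ x ↦ c ]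
  update-comm s {x} {y} c d x≢y z = by-cases (z ≟V y) (z ≟V x)
    where
      by-cases : Dec (z ≡ y) → Dec (z ≡ x) → ((s [ x ↦ c ]) [ y ↦ d ]) z ≡ ((s [ y ↦ d ]) [ x ↦ c ]) z
      by-cases (yes refl) _ = trans (update-at _ z d)
        (sym (trans (update-elsewhere _ c (x≢y ∘ sym)) (update-at s z d)))
      by-cases (no z≢y) (yes refl) = trans (update-elsewhere _ d z≢y)
        (trans (update-at s z c) (sym (update-at _ z c)))
      by-cases (no z≢y) (no z≢x) = trans (update-elsewhere _ d z≢y)
        (trans (update-elsewhere s c z≢x)
          (sym (trans (update-elsewhere _ c z≢x) (update-elsewhere s d z≢y))))

  update-id : ∀ s {x c} → s x ≡ c → s [ x ↦ c ] ≗ s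
  update-id s {x} s-x≡c y with y ≟V x
  ... | yes refl = sym s-x≡c
  ... | no _     = refl

  update-idem : ∀ s x c d → (s [ x ↦ c ]) [ x ↦ d ] ≗ s [ x ↦ d ]
  update-idem s x c d y with y ≟V x
  ... | yes _   = refl
  ... | no y≢x = update-elsewhere s c y≢x

  mutual
    eval-local : ∀ {s s′} e → (∀ {y} → y ∈ termVars e → s y ≡ s′ y) → eval s e ≡ eval s′ e
    eval-local (v x)      agree = agree (here refl)
    eval-local (app f ts) agree rewrite evalV-local ts agree = refl

    evalV-local : ∀ {s s′ n} (ts : Vec Term n) → (∀ {y} → y ∈ termVarsV ts → s y ≡ s′ y) →
                  evalV s ts ≡ evalV s′ ts
    evalV-local []       agree = refl
    evalV-local (e ∷ ts) agree
      rewrite eval-local e (agree ∘ ∈-++⁺ˡ) | evalV-local ts (agree ∘ ∈-++⁺ʳ (termVars e)) = refl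

  ⊨q-local : ∀ {s s′} π → (∀ {y} → y ∈ qfVars π → s y ≡ s′ y) → (s ⊨q π) ⇔ (s′ ⊨q π)
  ⊨q-local (e ≐ e′) agree
    rewrite eval-local e (agree ∘ ∈-++⁺ˡ) | eval-local e′ (agree ∘ ∈-++⁺ʳ (termVars e)) = ⇔.refl
  ⊨q-local (rel R ts) agree rewrite evalV-local ts agree = ⇔.refl
  ⊨q-local (π ∧q ρ)   agree =
    ⊨q-local π (agree ∘ ∈-++⁺ˡ) ×-⇔ ⊨q-local ρ (agree ∘ ∈-++⁺ʳ (qfVars π))
  ⊨q-local (¬q π)     agree = ¬-cong-⇔ (⊨q-local π agree)

  mutual
    eval-defined : ∀ {s} e → (∀ {y} → y ∈ termVars e → Defined (s y)) → Defined (eval s e)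
    eval-defined (v x)      defined = defined (here refl)
    eval-defined (app f ts) defined with evalV-defined ts defined
    ... | ds , evalV≡ rewrite evalV≡ = fInterp f ds , refl

    evalV-defined : ∀ {s n} (ts : Vec Term n) → (∀ {y} → y ∈ termVarsV ts → Defined (s y)) →
                    Σ (Vec D n) λ ds → evalV s ts ≡ just ds
    evalV-defined []       defined = [] , refl
    evalV-defined (e ∷ ts) defined
      with eval-defined e (defined ∘ ∈-++⁺ˡ) | evalV-defined ts (defined ∘ ∈-++⁺ʳ (termVars e))
    ... | d , eval≡ | ds , evalV≡ rewrite eval≡ | evalV≡ = d ∷ ds , refl

  assignment : Var m → Term → Var m → State → State
  assignment x e k s = (s [ k ↦ s x ]) [ x ↦ eval s e ]

  assignment-at-x : ∀ x e k s → assignment x e k s x ≡ eval s e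
  assignment-at-x x e k s = update-at (s [ k ↦ s x ]) x (eval s e)

  assignment-at-k : ∀ x e k s → x ≢ k → assignment x e k s k ≡ s x
  assignment-at-k x e k s x≢k =
    trans (update-elsewhere (s [ k ↦ s x ]) (eval s e) (x≢k ∘ sym)) (update-at s k (s x))

  assignment-elsewhere : ∀ x e k s {y} → y ≢ x → y ≢ k → assignment x e k s y ≡ s y
  assignment-elsewhere x e k s y≢x y≢k =
    trans (update-elsewhere (s [ k ↦ s x ]) (eval s e) y≢x) (update-elsewhere s (s x) y≢k)

  ≈-resp-≗ : ∀ {a s s′ t} → s ≗ s′ → (t ≈⟨ a ⟩ s) ⇔ (t ≈⟨ a ⟩ s′)
  ≈-resp-≗ s≗s′ = mk⇔ (λ t≈s y a∈ → trans (t≈s y a∈) (s≗s′ y))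
                      (λ t≈s′ y a∈ → trans (t≈s′ y a∈) (sym (s≗s′ y)))

  ⊨-resp-≗ : ∀ {M s s′} α → s ≗ s′ → (M , s ⊨ α) ⇔ (M , s′ ⊨ α)
  ⊨-resp-≗ (qf π)     s≗s′ = ⊨q-local π (λ {y} _ → s≗s′ y)
  ⊨-resp-≗ (fand α β) s≗s′ = ⊨-resp-≗ α s≗s′ ×-⇔ ⊨-resp-≗ β s≗s′
  ⊨-resp-≗ (fneg α)   s≗s′ = ¬-cong-⇔ (⊨-resp-≗ α s≗s′)
  ⊨-resp-≗ (fK a α)   s≗s′ = Π-⇔ λ _ → →-cong-⇔ ⇔.refl (→-cong-⇔ (≈-resp-≗ s≗s′) ⇔.refl)
  ⊨-resp-≗ (fann β α) s≗s′ = →-cong-⇔ (⊨-resp-≗ β s≗s′) (⊨-resp-≗ α s≗s′)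
  ⊨-resp-≗ (fall x α) s≗s′ = Π-⇔ λ c → ⊨-resp-≗ α (update-cong x (just c) s≗s′)

  Cyl-resp-≋ : ∀ {M N} x → M ≋ N → Cyl x M ≋ Cyl x N
  Cyl-resp-≋ x M≋N s′ = mk⇔ (λ (s , Ms , upd) → s , to (M≋N s) Ms , upd)
                            (λ (s , Ns , upd) → s , from (M≋N s) Ns , upd)

  mutual
    ⊨-resp-≋ : ∀ {M N s} α → M ≋ N → (M , s ⊨ α) ⇔ (N , s ⊨ α)
    ⊨-resp-≋ (qf π)     M≋N = ⇔.refl
    ⊨-resp-≋ (fand α β) M≋N = ⊨-resp-≋ α M≋N ×-⇔ ⊨-resp-≋ β M≋N
    ⊨-resp-≋ (fneg α)   M≋N = ¬-cong-⇔ (⊨-resp-≋ α M≋N)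
    ⊨-resp-≋ (fK a α)   M≋N = Π-⇔ λ s′ → →-cong-⇔ (M≋N s′) (→-cong-⇔ ⇔.refl (⊨-resp-≋ α M≋N))
    ⊨-resp-≋ (fann β α) M≋N = →-cong-⇔ (⊨-resp-≋ β M≋N) (⊨-resp-≋ α (∣-resp-≋ β M≋N))
    ⊨-resp-≋ (fall x α) M≋N = Π-⇔ λ _ → ⊨-resp-≋ α (Cyl-resp-≋ x M≋N)

    ∣-resp-≋ : ∀ {M N} β → M ≋ N → M ∣ β ≋ N ∣ β
    ∣-resp-≋ β M≋N s = M≋N s ×-⇔ ⊨-resp-≋ β M≋N

  ⊨M-resp-≋ : ∀ {M N} α → M ≋ N → (M ⊨M α) ⇔ (N ⊨M α)
  ⊨M-resp-≋ α M≋N = Π-⇔ λ s → →-cong-⇔ (M≋N s) (⊨-resp-≋ α M≋N)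

  Img-extensional : ∀ f M → Extensional (Img f M)
  Img-extensional f M s≗t (s₀ , Ms₀ , s≗fs₀) = s₀ , Ms₀ , λ y → trans (sym (s≗t y)) (s≗fs₀ y)

  Cyl-extensional : ∀ x M → Extensional (Cyl x M)
  Cyl-extensional x M s≗t (s₀ , Ms₀ , d , s≗s₀[x↦d]) =
    s₀ , Ms₀ , d , λ y → trans (sym (s≗t y)) (s≗s₀[x↦d] y)

  ∣-extensional : ∀ {M} β → Extensional M → Extensional (M ∣ β)
  ∣-extensional β M-ext s≗t (Ms , s⊨β) = M-ext s≗t Ms , to (⊨-resp-≗ β s≗t) s⊨β

  update-≈ : ∀ {a s t} x c → s ≈⟨ a ⟩ t → (s [ x ↦ c ]) ≈⟨ a ⟩ (t [ x ↦ c ])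
  update-≈ x c s≈t y a∈ with y ≟V x
  ... | yes _ = refl
  ... | no _  = s≈t y a∈

  undefined-outside-dom : ∀ {M s y} → ¬ InDom M y → M s → s y ≡ nothing
  undefined-outside-dom {s = s} {y} y∉dom Ms with s y in s-y≡
  ... | just d  = contradiction (s , Ms , d , s-y≡) y∉dom
  ... | nothing = refl

  ⊨M-Cyl : ∀ x W α → (Cyl x W ⊨M α) ⇔ (W ⊨M fall x α)
  ⊨M-Cyl x W α = mk⇔
    (λ Cyl⊨α s Ws c → Cyl⊨α (s [ x ↦ just c ]) (s , Ws , c , λ _ → refl))
    (λ W⊨∀α s (s₀ , Ws₀ , d , s≗s₀[x↦d]) → from (⊨-resp-≗ α s≗s₀[x↦d]) (W⊨∀α s₀ Ws₀ d))

  module Renaming (x k : Var m) (x≢k : x ≢ k) (grp-k≡grp-x : Var.grp k ≡ Var.grp x) where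

    swap : Var m → Var m
    swap y with y ≟V x
    ... | yes _ = k
    ... | no _ with y ≟V k
    ...   | yes _ = x
    ...   | no _  = y

    swap-x : swap x ≡ k
    swap-x with x ≟V x
    ... | yes _   = refl
    ... | no x≢x = contradiction refl x≢x

    swap-k : swap k ≡ x
    swap-k with k ≟V x
    ... | yes k≡x = contradiction (sym k≡x) x≢k
    ... | no _ with k ≟V k
    ...   | yes _   = refl
    ...   | no k≢k = contradiction refl k≢k

    swap-other : ∀ {y} → y ≢ x → y ≢ k → swap y ≡ y
    swap-other {y} y≢x y≢k with y ≟V x
    ... | yes y≡x = contradiction y≡x y≢x
    ... | no _ with y ≟V k
    ...   | yes y≡k = contradiction y≡k y≢k
    ...   | no _    = refl

    swap-involutive : ∀ y → swap (swap y) ≡ y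
    swap-involutive y = by-cases (y ≟V x) (y ≟V k)
      where
        by-cases : Dec (y ≡ x) → Dec (y ≡ k) → swap (swap y) ≡ y
        by-cases (yes y≡x) _       rewrite y≡x = trans (cong swap swap-x) swap-k
        by-cases (no _)    (yes y≡k) rewrite y≡k = trans (cong swap swap-k) swap-x
        by-cases (no y≢x)  (no y≢k)  = trans (cong swap (swap-other y≢x y≢k)) (swap-other y≢x y≢k)

    swap-grp : ∀ y → Var.grp (swap y) ≡ Var.grp y
    swap-grp y = by-cases (y ≟V x) (y ≟V k)
      where
        by-cases : Dec (y ≡ x) → Dec (y ≡ k) → Var.grp (swap y) ≡ Var.grp y
        by-cases (yes y≡x) _       rewrite y≡x = trans (cong Var.grp swap-x) grp-k≡grp-x
        by-cases (no _)    (yes y≡k) rewrite y≡k = trans (cong Var.grp swap-k) (sym grp-k≡grp-x)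
        by-cases (no y≢x)  (no y≢k)  = cong Var.grp (swap-other y≢x y≢k)

    σ : State → State
    σ s y = s (swap y)

    -- σ is an involution, so this preimage of M is also its image under σ.
    σᴹ : Model → Model
    σᴹ M = M ∘ σ

    σ-involutive : ∀ s → σ (σ s) ≗ s
    σ-involutive s = cong s ∘ swap-involutive

    σ-cong : ∀ {s t} → s ≗ t → σ s ≗ σ t
    σ-cong s≗t = s≗t ∘ swap

    σ-update : ∀ s {y} c → y ≢ x → y ≢ k → σ (s [ y ↦ c ]) ≗ σ s [ y ↦ c ]
    σ-update s {y} c y≢x y≢k z with z ≟V y
    ... | yes refl rewrite swap-other y≢x y≢k = update-at s z c
    ... | no z≢y   = update-elsewhere s c (z≢y ∘ swap-injective)
      where
        swap-injective : swap z ≡ y → z ≡ y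
        swap-injective swap-z≡y = trans (sym (swap-involutive z))
                                        (trans (cong swap swap-z≡y) (swap-other y≢x y≢k))

    σ-≈ : ∀ {a s t} → s ≈⟨ a ⟩ t → σ s ≈⟨ a ⟩ σ t
    σ-≈ {a} s≈t y a∈ = s≈t (swap y) (subst (a ∈ˢ_) (sym (swap-grp y)) a∈)

    σ-∈ : ∀ {M s} → Extensional M → M s → σᴹ M (σ s)
    σ-∈ M-ext Ms = M-ext (≗.sym (σ-involutive _)) Ms

    mutual
      eval-subst : ∀ {s} e → k ∉ termVars e → eval s (substT x k e) ≡ eval (σ s) e
      eval-subst {s} (v y) k∉ with y ≟V x
      ... | yes _   = refl
      ... | no _ with y ≟V k
      ...   | yes y≡k = contradiction (here (sym y≡k)) k∉
      ...   | no _    = refl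
      eval-subst {s} (app f ts) k∉ rewrite evalV-subst {s} ts k∉ = refl

      evalV-subst : ∀ {s n} (ts : Vec Term n) → k ∉ termVarsV ts →
                    evalV s (substTV x k ts) ≡ evalV (σ s) ts
      evalV-subst []           k∉ = refl
      evalV-subst {s} (e ∷ ts) k∉
        rewrite eval-subst {s} e (k∉ ∘ ∈-++⁺ˡ) | evalV-subst {s} ts (k∉ ∘ ∈-++⁺ʳ (termVars e)) = refl

    ⊨q-subst : ∀ {s} π → k ∉ qfVars π → (s ⊨q substQ x k π) ⇔ (σ s ⊨q π)
    ⊨q-subst {s} (e ≐ e′) k∉
      rewrite eval-subst {s} e (k∉ ∘ ∈-++⁺ˡ) | eval-subst {s} e′ (k∉ ∘ ∈-++⁺ʳ (termVars e)) = ⇔.refl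
    ⊨q-subst {s} (rel R ts) k∉ rewrite evalV-subst {s} ts k∉ = ⇔.refl
    ⊨q-subst (π ∧q ρ)   k∉ =
      ⊨q-subst π (k∉ ∘ ∈-++⁺ˡ) ×-⇔ ⊨q-subst ρ (k∉ ∘ ∈-++⁺ʳ (qfVars π))
    ⊨q-subst (¬q π)     k∉ = ¬-cong-⇔ (⊨q-subst π k∉)

    σᴹ-Cyl : ∀ {M y} → Extensional M → y ≢ x → y ≢ k → σᴹ (Cyl y M) ≋ Cyl y (σᴹ M)
    σᴹ-Cyl {M} {y} M-ext y≢x y≢k u = mk⇔
      (λ (s , Ms , d , σu≗) → σ s , σ-∈ M-ext Ms , d , ≗.trans (≗.sym (σ-involutive u))
                                   (≗.trans (σ-cong σu≗) (σ-update s (just d) y≢x y≢k)))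
      (λ (s , Mσs , d , u≗) → σ s , Mσs , d , ≗.trans (σ-cong u≗) (σ-update s (just d) y≢x y≢k))

    ⊨-subst : ∀ {M s} α → Extensional M → k ∉ formVars α → x ∉ boundVars α →
              (M , s ⊨ substF x k α) ⇔ (σᴹ M , σ s ⊨ α)
    ⊨-subst (qf π) _ k∉ _ = ⊨q-subst π k∉
    ⊨-subst (fand α β) M-ext k∉ x∉ =
      ⊨-subst α M-ext (k∉ ∘ ∈-++⁺ˡ) (x∉ ∘ ∈-++⁺ˡ)
        ×-⇔ ⊨-subst β M-ext (k∉ ∘ ∈-++⁺ʳ (formVars α)) (x∉ ∘ ∈-++⁺ʳ (boundVars α))
    ⊨-subst (fneg α) M-ext k∉ x∉ = ¬-cong-⇔ (⊨-subst α M-ext k∉ x∉)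
    ⊨-subst {M} {s} (fK a α) M-ext k∉ x∉ = mk⇔
      (λ K w Mσw w≈σs → to (⊨-resp-≗ α (σ-involutive w))
        (to (⊨-subst α M-ext k∉ x∉) (K (σ w) Mσw (to (≈-resp-≗ (σ-involutive s)) (σ-≈ w≈σs)))))
      (λ K s′ Ms′ s′≈s → from (⊨-subst α M-ext k∉ x∉) (K (σ s′) (σ-∈ M-ext Ms′) (σ-≈ s′≈s)))
    ⊨-subst {M} (fann β α) M-ext k∉ x∉ =
      →-cong-⇔ (⊨-subst β M-ext k∉β x∉β)
        (⇔.trans (⊨-subst α (∣-extensional β′ M-ext) k∉α x∉α) (⊨-resp-≋ α σᴹ-∣))
      where
        β′ = substF x k β
        k∉β = k∉ ∘ ∈-++⁺ˡ
        x∉β = x∉ ∘ ∈-++⁺ˡ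
        k∉α = k∉ ∘ ∈-++⁺ʳ (formVars β)
        x∉α = x∉ ∘ ∈-++⁺ʳ (boundVars β)
        σᴹ-∣ : σᴹ (M ∣ β′) ≋ σᴹ M ∣ β
        σᴹ-∣ u = ⇔.refl ×-⇔ ⇔.trans (⊨-subst β M-ext k∉β x∉β) (⊨-resp-≗ β (σ-involutive u))
    ⊨-subst {M} {s} (fall y α) M-ext k∉ x∉ with y ≟V x
    ... | yes y≡x = contradiction (here (sym y≡x)) x∉
    ... | no y≢x  = Π-⇔ λ c →
      ⇔.trans (⊨-subst α (Cyl-extensional y M) (k∉ ∘ there) (x∉ ∘ there))
        (⇔.trans (⊨-resp-≗ α (σ-update s (just c) y≢x y≢k)) (⊨-resp-≋ α (σᴹ-Cyl M-ext y≢x y≢k)))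
      where
        y≢k : y ≢ k
        y≢k y≡k = k∉ (here (sym y≡k))

    ⊨M-subst : ∀ {M} α → Extensional M → k ∉ formVars α → x ∉ boundVars α →
               (M ⊨M substF x k α) ⇔ (σᴹ M ⊨M α)
    ⊨M-subst α M-ext k∉ x∉ = mk⇔
      (λ M⊨ w Mσw → to (⊨-resp-≗ α (σ-involutive w)) (to (⊨-subst α M-ext k∉ x∉) (M⊨ (σ w) Mσw)))
      (λ σᴹM⊨ s Ms → from (⊨-subst α M-ext k∉ x∉) (σᴹM⊨ (σ s) (σ-∈ M-ext Ms)))

    σ-assignment : ∀ {s a} e → eval s e ≡ just a → σ (s [ k ↦ just a ]) ≗ assignment x e k s
    σ-assignment {s} {a} e eval≡a z = by-cases (z ≟V x) (z ≟V k)
      where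
        by-cases : Dec (z ≡ x) → Dec (z ≡ k) → σ (s [ k ↦ just a ]) z ≡ assignment x e k s z
        by-cases (yes z≡x) _ rewrite z≡x =
          trans (cong (s [ k ↦ just a ]) swap-x)
                (trans (update-at s k (just a)) (sym (trans (assignment-at-x x e k s) eval≡a)))
        by-cases (no _) (yes z≡k) rewrite z≡k =
          trans (cong (s [ k ↦ just a ]) swap-k)
                (trans (update-elsewhere s (just a) x≢k) (sym (assignment-at-k x e k s x≢k)))
        by-cases (no z≢x) (no z≢k) =
          trans (cong (s [ k ↦ just a ]) (swap-other z≢x z≢k))
                (trans (update-elsewhere s (just a) z≢k) (sym (assignment-elsewhere x e k s z≢x z≢k)))

    assign-image : ∀ {W} e → k ∉ termVars e → (∀ {s} → W s → Defined (eval s e)) →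
                   Img (assignment x e k) W ≋ σᴹ (Cyl k W ∣ qf (v k ≐ e))
    assign-image {W} e k∉e defined u = mk⇔ forward backward
      where
        eval-k-irrelevant : ∀ s c → eval (s [ k ↦ c ]) e ≡ eval s e
        eval-k-irrelevant s c = eval-local e λ y∈ → update-elsewhere s c λ { refl → k∉e y∈ }

        forward : Img (assignment x e k) W u → σᴹ (Cyl k W ∣ qf (v k ≐ e)) u
        forward (s , Ws , u≗) = (s , Ws , a , σu≗) , a , trans (σu≗ k) (update-at s k (just a)) ,
          trans (eval-local e λ {y} _ → σu≗ y) (trans (eval-k-irrelevant s (just a)) eval≡a)
          where
            a = proj₁ (defined Ws)
            eval≡a = proj₂ (defined Ws)
            σu≗ : σ u ≗ s [ k ↦ just a ]
            σu≗ = ≗.trans (σ-cong (≗.trans u≗ (≗.sym (σ-assignment e eval≡a)))) (σ-involutive _)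

        backward : σᴹ (Cyl k W ∣ qf (v k ≐ e)) u → Img (assignment x e k) W u
        backward ((s , Ws , d , σu≗) , a , σu-k≡a , eval-σu≡a) =
          s , Ws , ≗.trans (≗.sym (σ-involutive u)) (≗.trans (σ-cong σu≗) (σ-assignment e eval≡d))
          where
            eval≡d : eval s e ≡ just d
            eval≡d = begin
              eval s e                  ≡⟨ sym (eval-k-irrelevant s (just d)) ⟩
              eval (s [ k ↦ just d ]) e ≡⟨ sym (eval-local e λ {y} _ → σu≗ y) ⟩
              eval (σ u) e              ≡⟨ eval-σu≡a ⟩
              just a                    ≡⟨ sym σu-k≡a ⟩
              σ u k                     ≡⟨ σu≗ k ⟩
              (s [ k ↦ just d ]) k      ≡⟨ update-at s k (just d) ⟩
              just d                    ∎
              where open ≡-Reasoning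

  grp≡Ag⇒public : ∀ (c : Var m) → Var.grp c ≡ Ag → ∀ a → a ∈ˢ Var.grp c
  grp≡Ag⇒public c grp-c a = subst (a ∈ˢ_) (sym grp-c) ∈⊤

  module Tagging (c : Var m) (c-public : ∀ a → a ∈ˢ Var.grp c) where

    tag : D → State → State
    tag a s = s [ c ↦ just a ]

    untag : State → State
    untag s = s [ c ↦ nothing ]

    Slice : D → Model → Model
    Slice a U s = U (tag a s) × s c ≡ nothing

    Tag : D → D → Model → Model → Model
    Tag a b M N = Img (tag a) M ∪ Img (tag b) N

    tag-untag : ∀ {a s} → s c ≡ just a → s ≗ tag a (untag s)
    tag-untag {a} {s} s-c≡a =
      ≗.trans (≗.sym (update-id s s-c≡a)) (≗.sym (update-idem s c nothing (just a)))

    untag-tag : ∀ {a s} → s c ≡ nothing → s ≗ untag (tag a s)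
    untag-tag {a} {s} s-c≡nothing =
      ≗.trans (≗.sym (update-id s s-c≡nothing)) (≗.sym (update-idem s c (just a) nothing))

    tag-cancel : ∀ {a s t} → s c ≡ nothing → t c ≡ nothing → tag a s ≗ tag a t → s ≗ t
    tag-cancel s-c t-c ts≗tt =
      ≗.trans (untag-tag s-c) (≗.trans (update-cong c nothing ts≗tt) (≗.sym (untag-tag t-c)))

    tag-value : ∀ {a b s t} → tag a s ≗ tag b t → a ≡ b
    tag-value {a} {b} {s} {t} ts≗tt =
      just-injective (trans (sym (update-at s c (just a))) (trans (ts≗tt c) (update-at t c (just b))))

    Slice-resp-≋ : ∀ {a U V} → U ≋ V → Slice a U ≋ Slice a V
    Slice-resp-≋ {a} U≋V s = U≋V (tag a s) ×-⇔ ⇔.refl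

    Slice-Cyl : ∀ {a U y} → Extensional U → y ≢ c → Slice a (Cyl y U) ≋ Cyl y (Slice a U)
    Slice-Cyl {a} {U} {y} U-ext y≢c u = mk⇔
      (λ ((s , Us , d , tu≗) , u-c) →
        let s-c : s c ≡ just a
            s-c = trans (sym (update-elsewhere s (just d) (y≢c ∘ sym)))
                        (trans (sym (tu≗ c)) (update-at u c (just a)))
        in untag s , (U-ext (tag-untag s-c) Us , update-at s c nothing) , d ,
           ≗.trans (untag-tag u-c)
             (≗.trans (update-cong c nothing tu≗) (update-comm s (just d) nothing y≢c)))
      (λ (s , (U-ts , s-c) , d , u≗) →
        (tag a s , U-ts , d , ≗.trans (update-cong c (just a) u≗) (update-comm s (just d) (just a) y≢c)) ,
        trans (u≗ c) (trans (update-elsewhere s (just d) (y≢c ∘ sym)) s-c))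

    ⊨-tag : ∀ {U s a} α → Extensional U → c ∉ formVars α → s c ≡ nothing →
            (U , tag a s ⊨ α) ⇔ (Slice a U , s ⊨ α)
    ⊨-tag {s = s} {a} (qf π) _ c∉ _ =
      ⊨q-local π λ y∈ → update-elsewhere s (just a) λ { refl → c∉ y∈ }
    ⊨-tag (fand α β) U-ext c∉ s-c =
      ⊨-tag α U-ext (c∉ ∘ ∈-++⁺ˡ) s-c ×-⇔ ⊨-tag β U-ext (c∉ ∘ ∈-++⁺ʳ (formVars α)) s-c
    ⊨-tag (fneg α) U-ext c∉ s-c = ¬-cong-⇔ (⊨-tag α U-ext c∉ s-c)
    ⊨-tag {U} {s} {a} (fK b α) U-ext c∉ s-c = mk⇔
      (λ K s₁ (U-ts₁ , s₁-c) s₁≈s →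
        to (⊨-tag α U-ext c∉ s₁-c) (K (tag a s₁) U-ts₁ (update-≈ c (just a) s₁≈s)))
      untagged
      where
        untagged : (Slice a U , s ⊨ fK b α) → ∀ s′ → U s′ → s′ ≈⟨ b ⟩ tag a s → U , s′ ⊨ α
        untagged K s′ Us′ s′≈ts =
          from (⊨-resp-≗ α s′≗) (from (⊨-tag α U-ext c∉ (update-at s′ c nothing))
            (K (untag s′) (U-ext s′≗ Us′ , update-at s′ c nothing)
               (to (≈-resp-≗ (≗.sym (untag-tag s-c))) (update-≈ c nothing s′≈ts))))
          where
            -- b observes c, so s′ carries the same tag a as tag a s.
            s′≗ : s′ ≗ tag a (untag s′)
            s′≗ = tag-untag (trans (s′≈ts c (c-public b)) (update-at s c (just a)))
    ⊨-tag {U} {s} {a} (fann β α) U-ext c∉ s-c =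
      →-cong-⇔ (⊨-tag β U-ext c∉β s-c)
        (⇔.trans (⊨-tag α (∣-extensional β U-ext) c∉α s-c) (⊨-resp-≋ α Slice-∣))
      where
        c∉β = c∉ ∘ ∈-++⁺ˡ
        c∉α = c∉ ∘ ∈-++⁺ʳ (formVars β)
        Slice-∣ : Slice a (U ∣ β) ≋ Slice a U ∣ β
        Slice-∣ u = mk⇔
          (λ ((U-tu , ⊨β) , u-c) → (U-tu , u-c) , to (⊨-tag β U-ext c∉β u-c) ⊨β)
          (λ ((U-tu , u-c) , ⊨β) → (U-tu , from (⊨-tag β U-ext c∉β u-c) ⊨β) , u-c)
    ⊨-tag {U} {s} {a} (fall y α) U-ext c∉ s-c = Π-⇔ λ d →
      ⇔.trans (⊨-resp-≗ α (update-comm s (just a) (just d) (y≢c ∘ sym)))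
        (⇔.trans (⊨-tag α (Cyl-extensional y U) (c∉ ∘ there)
                   (trans (update-elsewhere s (just d) (y≢c ∘ sym)) s-c))
          (⊨-resp-≋ α (Slice-Cyl U-ext y≢c)))
      where
        y≢c : y ≢ c
        y≢c y≡c = c∉ (here (sym y≡c))

    Tag-extensional : ∀ {a b M N} → Extensional (Tag a b M N)
    Tag-extensional {a} {b} {M} {N} s≗t =
      Sum.map (Img-extensional (tag a) M s≗t) (Img-extensional (tag b) N s≗t)

    Tag-comm : ∀ {a b M N} → Tag a b M N ≋ Tag b a N M
    Tag-comm _ = mk⇔ Sum.swap Sum.swap

    Slice-Tag : ∀ {a b M N} → a ≢ b → Extensional M → ¬ InDom M c → Slice a (Tag a b M N) ≋ M
    Slice-Tag a≢b M-ext c∉dom s = mk⇔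
      (λ { (inj₁ (s₁ , Ms₁ , ts≗ts₁) , s-c) →
             M-ext (≗.sym (tag-cancel s-c (undefined-outside-dom c∉dom Ms₁) ts≗ts₁)) Ms₁
         ; (inj₂ (_ , _ , ts≗ts₂) , _) → contradiction (tag-value ts≗ts₂) a≢b })
      (λ Ms → inj₁ (s , Ms , λ _ → refl) , undefined-outside-dom c∉dom Ms)

    ⊨-tag-Slice : ∀ {U M a s} α → Extensional U → c ∉ formVars α → Slice a U ≋ M → M s →
                  (U , tag a s ⊨ α) ⇔ (M , s ⊨ α)
    ⊨-tag-Slice α U-ext c∉ slice≋ Ms =
      ⇔.trans (⊨-tag α U-ext c∉ (proj₂ (from (slice≋ _) Ms))) (⊨-resp-≋ α slice≋)

    ⊨M-Tag : ∀ {a b M N} α → a ≢ b → Extensional M → Extensional N → ¬ InDom M c → ¬ InDom N c →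
             c ∉ formVars α → (Tag a b M N ⊨M α) ⇔ ((M ⊨M α) × (N ⊨M α))
    ⊨M-Tag {a} {b} {M} {N} α a≢b M-ext N-ext c∉domM c∉domN c∉ = mk⇔
      (λ Tag⊨ → (λ s Ms → to (sliceᴹ Ms) (Tag⊨ (tag a s) (inj₁ (s , Ms , λ _ → refl))))
              , (λ s Ns → to (sliceᴺ Ns) (Tag⊨ (tag b s) (inj₂ (s , Ns , λ _ → refl)))))
      (λ { (M⊨ , _) s′ (inj₁ (s , Ms , s′≗)) → from (⊨-resp-≗ α s′≗) (from (sliceᴹ Ms) (M⊨ s Ms))
         ; (_ , N⊨) s′ (inj₂ (s , Ns , s′≗)) → from (⊨-resp-≗ α s′≗) (from (sliceᴺ Ns) (N⊨ s Ns)) })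
      where
        sliceᴹ : ∀ {s} → M s → (Tag a b M N , tag a s ⊨ α) ⇔ (M , s ⊨ α)
        sliceᴹ = ⊨-tag-Slice α Tag-extensional c∉ (Slice-Tag a≢b M-ext c∉domM)
        sliceᴺ : ∀ {s} → N s → (Tag a b M N , tag b s ⊨ α) ⇔ (N , s ⊨ α)
        sliceᴺ = ⊨-tag-Slice α Tag-extensional c∉
                   (λ s → ⇔.trans (Slice-resp-≋ Tag-comm s) (Slice-Tag (a≢b ∘ sym) N-ext c∉domN s))

  All-≢-filter⇔ : ∀ {Q : Var m → Set} x ys →
                  All Q (filter (λ y → ¬? (y ≟V x)) ys) ⇔ All (λ y → y ≢ x → Q y) ys
  All-≢-filter⇔ x = All-filter⇔ (λ y → ¬? (y ≟V x))

  All-formVars : ∀ {Q : Var m → Set} α → All Q (freeVars α) → All Q (boundVars α) → All Q (formVars α)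
  All-formVars (qf π)     free bound = free
  All-formVars (fand α β) free bound =
    All.++⁺ (All-formVars α (All.++⁻ˡ _ free) (All.++⁻ˡ _ bound))
            (All-formVars β (All.++⁻ʳ _ free) (All.++⁻ʳ _ bound))
  All-formVars (fneg α)   free bound = All-formVars α free bound
  All-formVars (fK a α)   free bound = All-formVars α free bound
  All-formVars (fann β α) free bound =
    All.++⁺ (All-formVars β (All.++⁻ˡ _ free) (All.++⁻ˡ _ bound))
            (All-formVars α (All.++⁻ʳ _ free) (All.++⁻ʳ _ bound))
  All-formVars {Q} (fall x α) free (Qx ∷ bound) =
    Qx ∷ All-formVars α (All.map at-x-or-not (to (All-≢-filter⇔ x (freeVars α)) free)) bound
    where
      at-x-or-not : ∀ {y} → (y ≢ x → Q y) → Q y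
      at-x-or-not {y} Q-if-≢ with y ≟V x
      ... | yes refl = Qx
      ... | no y≢x   = Q-if-≢ y≢x

  boundVars-subst : ∀ x k α → boundVars (substF x k α) ≡ boundVars α
  boundVars-subst x k (qf π)     = refl
  boundVars-subst x k (fand α β) = cong₂ _++_ (boundVars-subst x k α) (boundVars-subst x k β)
  boundVars-subst x k (fneg α)   = boundVars-subst x k α
  boundVars-subst x k (fK a α)   = boundVars-subst x k α
  boundVars-subst x k (fann β α) = cong₂ _++_ (boundVars-subst x k β) (boundVars-subst x k α)
  boundVars-subst x k (fall y α) with y ≟V x
  ... | yes _ = refl
  ... | no _  = cong (y ∷_) (boundVars-subst x k α)

  module _ {Q : Var m → Set} (x k : Var m) (Qk : Q k) where

    mutual
      termVars-subst : ∀ e → All Q (termVars e) → All Q (termVars (substT x k e))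
      termVars-subst (v y) (Qy ∷ []) with y ≟V x
      ... | yes _ = Qk ∷ []
      ... | no _  = Qy ∷ []
      termVars-subst (app f ts) all = termVarsV-subst ts all

      termVarsV-subst : ∀ {n} (ts : Vec Term n) → All Q (termVarsV ts) → All Q (termVarsV (substTV x k ts))
      termVarsV-subst []       all = []
      termVarsV-subst (e ∷ ts) all =
        All.++⁺ (termVars-subst e (All.++⁻ˡ _ all)) (termVarsV-subst ts (All.++⁻ʳ _ all))

    qfVars-subst : ∀ π → All Q (qfVars π) → All Q (qfVars (substQ x k π))
    qfVars-subst (e ≐ e′)   all =
      All.++⁺ (termVars-subst e (All.++⁻ˡ _ all)) (termVars-subst e′ (All.++⁻ʳ _ all))
    qfVars-subst (rel R ts) all = termVarsV-subst ts all
    qfVars-subst (π ∧q ρ)   all =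
      All.++⁺ (qfVars-subst π (All.++⁻ˡ _ all)) (qfVars-subst ρ (All.++⁻ʳ _ all))
    qfVars-subst (¬q π)     all = qfVars-subst π all

  freeVars-subst : ∀ {Q : Var m → Set} x k α → Q k → All Q (freeVars α) → All Q (freeVars (substF x k α))
  freeVars-subst x k (qf π)     Qk all = qfVars-subst x k Qk π all
  freeVars-subst x k (fand α β) Qk all =
    All.++⁺ (freeVars-subst x k α Qk (All.++⁻ˡ _ all)) (freeVars-subst x k β Qk (All.++⁻ʳ _ all))
  freeVars-subst x k (fneg α)   Qk all = freeVars-subst x k α Qk all
  freeVars-subst x k (fK a α)   Qk all = freeVars-subst x k α Qk all
  freeVars-subst x k (fann β α) Qk all =
    All.++⁺ (freeVars-subst x k β Qk (All.++⁻ˡ _ all)) (freeVars-subst x k α Qk (All.++⁻ʳ _ all))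
  freeVars-subst x k (fall y α) Qk all with y ≟V x
  ... | yes _ = all
  ... | no _  = from (All-≢-filter⇔ y _)
                  (freeVars-subst x k α (λ _ → Qk) (to (All-≢-filter⇔ y (freeVars α)) all))

  freeVars-wp : ∀ {sc df} P α → WF sc df P → All sc (freeVars α) → All sc (freeVars (wp P α))
  freeVars-wp (test β)       α (free-β , _) free = All.++⁺ free-β free
  freeVars-wp (assign x e k) α (_ , free-e , _) free =
    from (All-≢-filter⇔ k _)
      (k≢k-elim ∷ All.++⁺ (All.map (λ sc-y _ → sc-y) free-e)
                          (freeVars-subst x k α k≢k-elim (All.map (λ sc-y _ → sc-y) free)))
    where
      k≢k-elim : ∀ {A : Set} → k ≢ k → A
      k≢k-elim k≢k = contradiction refl k≢k
  freeVars-wp {sc} (new k P) α (_ , wf) free =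
    from (All-≢-filter⇔ k _) (All.map in-scope (freeVars-wp P α wf (All.map inj₁ free)))
    where
      in-scope : ∀ {y} → sc y ⊎ y ≡ k → y ≢ k → sc y
      in-scope (inj₁ sc-y) _   = sc-y
      in-scope (inj₂ y≡k) y≢k = contradiction y≡k y≢k
  freeVars-wp (seq P Q)      α (wf-P , wf-Q) free = freeVars-wp P (wp Q α) wf-P (freeVars-wp Q α wf-Q free)
  freeVars-wp (choice c P Q) α (_ , _ , _ , _ , wf-P , wf-Q) free =
    All.++⁺ (freeVars-wp P α wf-P free) (freeVars-wp Q α wf-Q free)

  boundVars-wp : ∀ {sc df} {R : Var m → Set} P α → WF sc df P → (∀ {y} → ¬ df y → R y) →
                 All R (boundVars α) → All R (boundVars (wp P α))
  boundVars-wp (test β)       α (_ , fresh-β) fresh bound = All.++⁺ (All.map fresh fresh-β) bound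
  boundVars-wp {R = R} (assign x e k) α (_ , _ , k∉df , _) fresh bound =
    fresh k∉df ∷ subst (All R) (sym (boundVars-subst x k α)) bound
  boundVars-wp (new k P)      α (k∉df , wf) fresh bound =
    fresh k∉df ∷ boundVars-wp P α wf (λ ∉df′ → fresh (∉df′ ∘ inj₁)) bound
  boundVars-wp (seq P Q)      α (wf-P , wf-Q) fresh bound =
    boundVars-wp P (wp Q α) wf-P fresh (boundVars-wp Q α wf-Q (λ ∉df′ → fresh (∉df′ ∘ inj₁)) bound)
  boundVars-wp (choice c P Q) α (_ , _ , _ , _ , wf-P , wf-Q) fresh bound =
    All.++⁺ (boundVars-wp P α wf-P fresh bound) (boundVars-wp Q α wf-Q fresh bound)

  -- The induction invariant

  record Scoped (sc df : Var m → Set) (W : Model) : Set where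
    field
      extensional : Extensional W
      defines     : ∀ {s y} → W s → sc y → Defined (s y)
      dom⊆        : ∀ {y} → InDom W y → df y
      scope⊆      : ∀ {y} → sc y → df y

  Scoped-mono : ∀ {sc sc′ df df′ W} → (∀ {y} → sc′ y → sc y) → (∀ {y} → df y → df′ y) →
                Scoped sc df W → Scoped sc′ df′ W
  Scoped-mono sc′⊆sc df⊆df′ W-scoped = record
    { extensional = extensional
    ; defines     = λ Ws → defines Ws ∘ sc′⊆sc
    ; dom⊆        = df⊆df′ ∘ dom⊆
    ; scope⊆      = df⊆df′ ∘ scope⊆ ∘ sc′⊆sc
    }
    where open Scoped W-scoped

  InDom-Img : ∀ {f M y} → (∀ s → f s y ≡ s y) → InDom (Img f M) y → InDom M y
  InDom-Img {y = y} f-y (s′ , (s , Ms , s′≗) , d , s′-y) =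
    s , Ms , d , trans (sym (f-y s)) (trans (sym (s′≗ y)) s′-y)

  InDom-Cyl : ∀ {x M y} → y ≢ x → InDom (Cyl x M) y → InDom M y
  InDom-Cyl {y = y} y≢x (s′ , (s , Ms , c , s′≗) , d , s′-y) =
    s , Ms , d , trans (sym (update-elsewhere s (just c) y≢x)) (trans (sym (s′≗ y)) s′-y)

  Scoped-∣ : ∀ {sc df W} β → Scoped sc df W → Scoped sc df (W ∣ β)
  Scoped-∣ β W-scoped = record
    { extensional = ∣-extensional β extensional
    ; defines     = defines ∘ proj₁
    ; dom⊆        = λ (s , (Ws , _) , d , s-y) → dom⊆ (s , Ws , d , s-y)
    ; scope⊆      = scope⊆
    }
    where open Scoped W-scoped

  Scoped-Cyl : ∀ {sc df W k} → ¬ df k → Scoped sc df W →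
               Scoped (λ y → sc y ⊎ y ≡ k) (λ y → df y ⊎ y ≡ k) (Cyl k W)
  Scoped-Cyl {sc} {df} {W} {k} k∉df W-scoped = record
    { extensional = Cyl-extensional k W
    ; defines     = defines′
    ; dom⊆        = dom⊆′
    ; scope⊆      = Sum.map₁ scope⊆
    }
    where
      open Scoped W-scoped
      defines′ : ∀ {s y} → Cyl k W s → sc y ⊎ y ≡ k → Defined (s y)
      defines′ {y = y} (s₀ , Ws₀ , d , s≗) (inj₁ sc-y) =
        let d′ , s₀-y = defines Ws₀ sc-y
        in d′ , trans (s≗ y) (trans (update-elsewhere s₀ (just d) λ { refl → k∉df (scope⊆ sc-y) }) s₀-y)
      defines′ {y = y} (s₀ , Ws₀ , d , s≗) (inj₂ refl) = d , trans (s≗ y) (update-at s₀ y (just d))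
      dom⊆′ : ∀ {y} → InDom (Cyl k W) y → df y ⊎ y ≡ k
      dom⊆′ {y} y∈dom with y ≟V k
      ... | yes y≡k = inj₂ y≡k
      ... | no y≢k  = inj₁ (dom⊆ (InDom-Cyl y≢k y∈dom))

  Scoped-assign : ∀ {sc df W} x e k → WF sc df (assign x e k) → Scoped sc df W →
                  Scoped sc (λ y → df y ⊎ y ∈ k ∷ []) (Img (assignment x e k) W)
  Scoped-assign {sc} {df} {W} x e k (sc-x , sc-e , k∉df , _) W-scoped = record
    { extensional = Img-extensional (assignment x e k) W
    ; defines     = defines′
    ; dom⊆        = dom⊆′
    ; scope⊆      = inj₁ ∘ scope⊆
    }
    where
      open Scoped W-scoped
      defines′ : ∀ {s′ y} → Img (assignment x e k) W s′ → sc y → Defined (s′ y)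
      defines′ {y = y} (s , Ws , s′≗) sc-y with y ≟V x
      ... | yes refl =
        let d , eval≡ = eval-defined e (defines Ws ∘ All.lookup sc-e)
        in d , trans (s′≗ y) (trans (assignment-at-x y e k s) eval≡)
      ... | no y≢x =
        let d , s-y = defines Ws sc-y
        in d , trans (s′≗ y) (trans (assignment-elsewhere x e k s y≢x λ { refl → k∉df (scope⊆ sc-y) }) s-y)
      dom⊆′ : ∀ {y} → InDom (Img (assignment x e k) W) y → df y ⊎ y ∈ k ∷ []
      dom⊆′ {y} y∈dom with y ≟V x | y ≟V k
      ... | yes refl | _        = inj₁ (scope⊆ sc-x)
      ... | no _     | yes refl = inj₂ (here refl)
      ... | no y≢x   | no y≢k   =
        inj₁ (dom⊆ (InDom-Img (λ s → assignment-elsewhere x e k s y≢x y≢k) y∈dom))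

  Scoped-Tag : ∀ {sc df₁ df₂ M N} c a b (c-public : ∀ i → i ∈ˢ Var.grp c) → ¬ sc c →
               Scoped sc df₁ M → Scoped sc df₂ N →
               Scoped sc (λ y → y ≡ c ⊎ df₁ y ⊎ df₂ y) (Tagging.Tag c c-public a b M N)
  Scoped-Tag {sc} {df₁} {df₂} {M} {N} c a b c-public c∉sc M-scoped N-scoped = record
    { extensional = Tag-extensional
    ; defines     = defines′
    ; dom⊆        = dom⊆′
    ; scope⊆      = inj₂ ∘ inj₁ ∘ Scoped.scope⊆ M-scoped
    }
    where
      open Tagging c c-public
      tag-elsewhere′ : ∀ {a y} → y ≢ c → ∀ s → tag a s y ≡ s y
      tag-elsewhere′ {a} y≢c s = update-elsewhere s (just a) y≢c
      tag-elsewhere : ∀ {a y} s → sc y → tag a s y ≡ s y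
      tag-elsewhere s sc-y = tag-elsewhere′ (λ { refl → c∉sc sc-y }) s
      defines′ : ∀ {s′ y} → Tag a b M N s′ → sc y → Defined (s′ y)
      defines′ {y = y} (inj₁ (s , Ms , s′≗)) sc-y =
        let d , s-y = Scoped.defines M-scoped Ms sc-y in d , trans (s′≗ y) (trans (tag-elsewhere s sc-y) s-y)
      defines′ {y = y} (inj₂ (s , Ns , s′≗)) sc-y =
        let d , s-y = Scoped.defines N-scoped Ns sc-y in d , trans (s′≗ y) (trans (tag-elsewhere s sc-y) s-y)
      dom⊆′ : ∀ {y} → InDom (Tag a b M N) y → y ≡ c ⊎ df₁ y ⊎ df₂ y
      dom⊆′ {y} y∈dom with y ≟V c
      ... | yes y≡c = inj₁ y≡c
      dom⊆′ (s′ , inj₁ s′∈ , d , s′-y) | no y≢c =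
        inj₂ (inj₁ (Scoped.dom⊆ M-scoped (InDom-Img (tag-elsewhere′ y≢c) (s′ , s′∈ , d , s′-y))))
      dom⊆′ (s′ , inj₂ s′∈ , d , s′-y) | no y≢c =
        inj₂ (inj₂ (Scoped.dom⊆ N-scoped (InDom-Img (tag-elsewhere′ y≢c) (s′ , s′∈ , d , s′-y))))

  Scoped-F : ∀ {sc df W} P → WF sc df P → Scoped sc df W → Scoped sc (λ y → df y ⊎ y ∈ intro P) (F P W)
  Scoped-F (test β)       _  W-scoped = Scoped-mono (λ sc-y → sc-y) inj₁ (Scoped-∣ β W-scoped)
  Scoped-F (assign x e k) wf W-scoped = Scoped-assign x e k wf W-scoped
  Scoped-F {df = df} (new k P) (k∉df , wf) W-scoped =
    Scoped-mono inj₁ reassoc (Scoped-F P wf (Scoped-Cyl k∉df W-scoped))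
    where
      reassoc : ∀ {y} → (df y ⊎ y ≡ k) ⊎ y ∈ intro P → df y ⊎ y ∈ k ∷ intro P
      reassoc (inj₁ (inj₁ df-y)) = inj₁ df-y
      reassoc (inj₁ (inj₂ y≡k))  = inj₂ (here y≡k)
      reassoc (inj₂ y∈P)         = inj₂ (there y∈P)
  Scoped-F {df = df} (seq P Q) (wf-P , wf-Q) W-scoped =
    Scoped-mono (λ sc-y → sc-y) reassoc (Scoped-F Q wf-Q (Scoped-F P wf-P W-scoped))
    where
      reassoc : ∀ {y} → (df y ⊎ y ∈ intro P) ⊎ y ∈ intro Q → df y ⊎ y ∈ intro P ++ intro Q
      reassoc (inj₁ (inj₁ df-y)) = inj₁ df-y
      reassoc (inj₁ (inj₂ y∈P))  = inj₂ (∈-++⁺ˡ y∈P)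
      reassoc (inj₂ y∈Q)         = inj₂ (∈-++⁺ʳ (intro P) y∈Q)
  Scoped-F {df = df} (choice c P Q) (c∉df , _ , _ , grp-c , wf-P , wf-Q) W-scoped =
    Scoped-mono (λ sc-y → sc-y) reassoc
      (Scoped-Tag c l r (grp≡Ag⇒public c grp-c) (c∉df ∘ Scoped.scope⊆ W-scoped)
        (Scoped-F P wf-P W-scoped) (Scoped-F Q wf-Q W-scoped))
    where
      reassoc : ∀ {y} → y ≡ c ⊎ (df y ⊎ y ∈ intro P) ⊎ (df y ⊎ y ∈ intro Q) →
                df y ⊎ y ∈ c ∷ intro P ++ intro Q
      reassoc (inj₁ y≡c)                = inj₂ (here y≡c)
      reassoc (inj₂ (inj₁ (inj₁ df-y))) = inj₁ df-y
      reassoc (inj₂ (inj₁ (inj₂ y∈P)))  = inj₂ (there (∈-++⁺ˡ y∈P))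
      reassoc (inj₂ (inj₂ (inj₁ df-y))) = inj₁ df-y
      reassoc (inj₂ (inj₂ (inj₂ y∈Q)))  = inj₂ (there (∈-++⁺ʳ (intro P) y∈Q))

  ⊨M-∣ : ∀ M β α → ((M ∣ β) ⊨M α) ⇔ (M ⊨M fann β α)
  ⊨M-∣ M β α = mk⇔ (λ M∣β⊨ s Ms s⊨β → M∣β⊨ s (Ms , s⊨β))
                    (λ M⊨ s (Ms , s⊨β) → M⊨ s Ms s⊨β)

  ⊨M-fand : ∀ M α β → ((M ⊨M α) × (M ⊨M β)) ⇔ (M ⊨M fand α β)
  ⊨M-fand M α β = mk⇔
    (λ (M⊨α , M⊨β) s Ms → M⊨α s Ms , M⊨β s Ms)
    (λ M⊨ → (λ s Ms → proj₁ (M⊨ s Ms)) , (λ s Ms → proj₂ (M⊨ s Ms)))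

  fresh-∉-formVars : ∀ {sc df : Var m → Set} {y} P α → (∀ {z} → sc z → df z) → ¬ df y →
                     y ∈ intro P → All sc (freeVars α) →
                     All (λ z → ¬ df z × z ∉ intro P) (boundVars α) → y ∉ formVars α
  fresh-∉-formVars P α scope⊆ y∉df y∈P free bound =
    All.All¬⇒¬Any (All-formVars α (All.map (λ { sc-z refl → y∉df (scope⊆ sc-z) }) free)
                                  (All.map (λ { (_ , z∉P) refl → z∉P y∈P }) bound))

  wp-correct : ∀ {sc df W} → l ≢ r → ∀ P α → WF sc df P → Scoped sc df W →
               All sc (freeVars α) → All (λ y → ¬ df y × y ∉ intro P) (boundVars α) →
               (F P W ⊨M α) ⇔ (W ⊨M wp P α)
  wp-correct l≢r (test β) α _ _ _ _ = ⊨M-∣ _ β α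
  wp-correct {W = W} l≢r (assign x e k) α (sc-x , sc-e , k∉df , grp-k) W-scoped free bound = begin
    Img (assignment x e k) W ⊨M α     ∼⟨ ⊨M-resp-≋ α (assign-image e k∉e defined) ⟩
    σᴹ (Cyl k W ∣ k≐e) ⊨M α           ∼⟨ ⇔.sym (⊨M-subst α (∣-extensional k≐e (Cyl-extensional k W))
                                                             k∉α x∉α) ⟩
    (Cyl k W ∣ k≐e) ⊨M substF x k α   ∼⟨ ⊨M-∣ (Cyl k W) k≐e (substF x k α) ⟩
    Cyl k W ⊨M fann k≐e (substF x k α) ∼⟨ ⊨M-Cyl k W (fann k≐e (substF x k α)) ⟩
    W ⊨M wp (assign x e k) α           ∎
    where
      open EquationalReasoning
      open Scoped W-scoped
      k≐e = qf (v k ≐ e)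
      x≢k : x ≢ k
      x≢k refl = k∉df (scope⊆ sc-x)
      open Renaming x k x≢k grp-k
      k∉e : k ∉ termVars e
      k∉e = All.All¬⇒¬Any (All.map (λ { sc-y refl → k∉df (scope⊆ sc-y) }) sc-e)
      defined : ∀ {s} → W s → Defined (eval s e)
      defined Ws = eval-defined e (defines Ws ∘ All.lookup sc-e)
      k∉α : k ∉ formVars α
      k∉α = fresh-∉-formVars (assign x e k) α scope⊆ k∉df (here refl) free bound
      x∉α : x ∉ boundVars α
      x∉α = All.All¬⇒¬Any (All.map (λ { (y∉df , _) refl → y∉df (scope⊆ sc-x) }) bound)
  wp-correct {df = df} {W} l≢r (new k P) α (k∉df , wf) W-scoped free bound =
    ⇔.trans (wp-correct l≢r P α wf (Scoped-Cyl k∉df W-scoped) (All.map inj₁ free) (All.map fresh bound))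
            (⊨M-Cyl k W (wp P α))
    where
      fresh : ∀ {y} → ¬ df y × y ∉ k ∷ intro P → ¬ (df y ⊎ y ≡ k) × y ∉ intro P
      fresh (y∉df , y∉kP) = Sum.[ y∉df , y∉kP ∘ here ] , y∉kP ∘ there
  wp-correct {df = df} l≢r (seq P Q) α (wf-P , wf-Q) W-scoped free bound =
    ⇔.trans (wp-correct l≢r Q α wf-Q (Scoped-F P wf-P W-scoped) free (All.map fresh-Q bound))
            (wp-correct l≢r P (wp Q α) wf-P W-scoped (freeVars-wp Q α wf-Q free)
              (boundVars-wp Q α wf-Q (λ ∉df′ → ∉df′ ∘ inj₁ , ∉df′ ∘ inj₂) (All.map fresh-P bound)))
    where
      fresh-Q : ∀ {y} → ¬ df y × y ∉ intro P ++ intro Q → ¬ (df y ⊎ y ∈ intro P) × y ∉ intro Q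
      fresh-Q (y∉df , y∉PQ) = Sum.[ y∉df , y∉PQ ∘ ∈-++⁺ˡ ] , y∉PQ ∘ ∈-++⁺ʳ (intro P)
      fresh-P : ∀ {y} → ¬ df y × y ∉ intro P ++ intro Q → ¬ df y × y ∉ intro P
      fresh-P (y∉df , y∉PQ) = y∉df , y∉PQ ∘ ∈-++⁺ˡ
  wp-correct {W = W} l≢r (choice c P Q) α (c∉df , c∉P , c∉Q , grp-c , wf-P , wf-Q)
             W-scoped free bound =
    begin
      Tag l r (F P W) (F Q W) ⊨M α     ∼⟨ ⊨M-Tag α l≢r (extensional P-scoped) (extensional Q-scoped)
                                               c∉dom-P c∉dom-Q c∉α ⟩
      ((F P W ⊨M α) × (F Q W ⊨M α))    ∼⟨ IH-P ×-⇔ IH-Q ⟩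
      ((W ⊨M wp P α) × (W ⊨M wp Q α))  ∼⟨ ⊨M-fand W (wp P α) (wp Q α) ⟩
      W ⊨M wp (choice c P Q) α          ∎
    where
      open EquationalReasoning
      open Tagging c (grp≡Ag⇒public c grp-c)
      open Scoped
      P-scoped = Scoped-F P wf-P W-scoped
      Q-scoped = Scoped-F Q wf-Q W-scoped
      c∉dom-P : ¬ InDom (F P W) c
      c∉dom-P = Sum.[ c∉df , c∉P ] ∘ dom⊆ P-scoped
      c∉dom-Q : ¬ InDom (F Q W) c
      c∉dom-Q = Sum.[ c∉df , c∉Q ] ∘ dom⊆ Q-scoped
      c∉α : c ∉ formVars α
      c∉α = fresh-∉-formVars (choice c P Q) α (scope⊆ W-scoped) c∉df (here refl) free bound
      IH-P = wp-correct l≢r P α wf-P W-scoped free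
               (All.map (λ (y∉df , y∉) → y∉df , y∉ ∘ there ∘ ∈-++⁺ˡ) bound)
      IH-Q = wp-correct l≢r Q α wf-Q W-scoped free
               (All.map (λ (y∉df , y∉) → y∉df , y∉ ∘ there ∘ ∈-++⁺ʳ (intro P)) bound)

mainTheorem2 : (m : ℕ) (S : Signature) (l r : Signature.D S) → l ≢ r →
    let open Signature S
        open Theory m S l r
    in (p : Var m → Set) → Σ (Var m) p →
       (P : Prog) (W : Model) (α : Form) →
       -- W is a set of states (closed under pointwise equality of functions)
       (∀ s s′ → W s → (∀ y → s y ≡ s′ y) → W s′) →
       -- the program variables are defined in every state of W
       (∀ s → W s → ∀ y → p y → Σ D λ d → s y ≡ just d) →
       -- P ∈ C, with fresh variables fresh w.r.t. the domain of the states
       WF p (λ y → p y ⊎ InDom W y) P →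
       All (λ k → k ∉ usedVars P) (auxVars P) →
       -- α has free variables in p; its quantified variables are fresh
       All p (freeVars α) →
       All (λ y → ¬ (p y ⊎ InDom W y) × y ∉ intro P) (boundVars α) →
       (F P W ⊨M α) ⇔ (W ⊨M wp P α)
mainTheorem2 m S l r l≢r p _ P W α W-closed defined wf _ free bound =
  wp-correct l≢r P α wf W-scoped free bound
  where
    open Theory m S l r
    open Semantics m S l r
    W-scoped : Scoped p (λ y → p y ⊎ InDom W y) W
    W-scoped = record
      { extensional = λ s≗t Ws → W-closed _ _ Ws s≗t
      ; defines     = λ Ws p-y → defined _ Ws _ p-y
      ; dom⊆        = inj₂
      ; scope⊆      = inj₁
      }
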